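{- Let $(A,\sigma)$ be a state-morphism BL-algebra. Then $(A,\sigma)$ is simple if and only if $\mathrm{Ker}(\sigma)$ is a maximal filter of $A$.
   Context: A BL-algebra is an algebra $(A,\wedge,\vee,\odot,\to,0,1)$ of type $(2,2,2,2,0,0)$ such that $(A,\wedge,\vee,0,1)$ is a bounded lattice, $(A,\odot,1)$ is a commutative monoid, and for all $a,b,c\in A$: $c\le a\to b$ iff $a\odot c\le b$; $a\wedge b=a\odot(a\to b)$; $(a\to b)\vee(b\to a)=1$. A morphism-state-operator on $A$ is a map $\sigma:A\to A$ such that for all $x,y\in A$: $\sigma(0)=0$; $\sigma(x\to y)=\sigma(x)\to\sigma(x\wedge y)$; $\sigma(\sigma(x)\odot\sigma(y))=\sigma(x)\odot\sigma(y)$; $\sigma(\sigma(x)\to\sigma(y))=\sigma(x)\to\sigma(y)$; $\sigma(x\odot y)=\sigma(x)\odot\sigma(y)$; then $(A,\sigma)$ is a state-morphism BL-algebra. The image $\sigma(A)$ is a subalgebra of $A$, regarded as a BL-algebra. $\mathrm{Ker}(\sigma)=\{x\in A:\sigma(x)=1\}$. A filter is a nonempty subset closed under $\odot$ and upward closed; a maximal filter is a proper filter not strictly contained in another proper filter. A BL-algebra is simple if it has exactly two filters. A state BL-algebra $(A,\sigma)$ is called simple if the BL-algebra $\sigma(A)$ is simple. -}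

module Defs where

open import Level using (Level; _⊔_) renaming (suc to lsuc)
open import Data.Product using (Σ; ∃; _×_; _,_)
open import Data.Sum using (_⊎_)
open import Data.Unit using (⊤)
open import Relation.Nullary using (¬_)
open import Relation.Unary using (Pred; _⊆_; _≐_)
open import Relation.Binary.PropositionalEquality using (_≡_)

record BLAlgebra (a : Level) : Set (lsuc a) where
  infixr 6 _∨_
  infixr 7 _∧_
  infixr 7 _⊙_
  infixr 5 _⇒_
  infix 4 _≤_
  field
    Carrier : Set a
    _∧_ _∨_ _⊙_ _⇒_ : Carrier → Carrier → Carrier
    𝟘 𝟙 : Carrier
    ∧-assoc : ∀ x y z → (x ∧ y) ∧ z ≡ x ∧ (y ∧ z)
    ∨-assoc : ∀ x y z → (x ∨ y) ∨ z ≡ x ∨ (y ∨ z)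
    ∧-comm : ∀ x y → x ∧ y ≡ y ∧ x
    ∨-comm : ∀ x y → x ∨ y ≡ y ∨ x
    ∧-absorbs-∨ : ∀ x y → x ∧ (x ∨ y) ≡ x
    ∨-absorbs-∧ : ∀ x y → x ∨ (x ∧ y) ≡ x
    𝟘-least : ∀ x → 𝟘 ∨ x ≡ x
    𝟙-greatest : ∀ x → 𝟙 ∧ x ≡ x
    ⊙-assoc : ∀ x y z → (x ⊙ y) ⊙ z ≡ x ⊙ (y ⊙ z)
    ⊙-comm : ∀ x y → x ⊙ y ≡ y ⊙ x
    ⊙-identityʳ : ∀ x → x ⊙ 𝟙 ≡ x

  _≤_ : Carrier → Carrier → Set a
  x ≤ y = x ∧ y ≡ x

  field
    residuation₁ : ∀ x y z → z ≤ (x ⇒ y) → x ⊙ z ≤ y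
    residuation₂ : ∀ x y z → x ⊙ z ≤ y → z ≤ (x ⇒ y)
    divisibility : ∀ x y → x ∧ y ≡ x ⊙ (x ⇒ y)
    prelinearity : ∀ x y → (x ⇒ y) ∨ (y ⇒ x) ≡ 𝟙

module _ {a : Level} (A : BLAlgebra a) where
  open BLAlgebra A

  record IsStateMorphism (σ : Carrier → Carrier) : Set a where
    field
      σ-𝟘 : σ 𝟘 ≡ 𝟘
      σ-⇒ : ∀ x y → σ (x ⇒ y) ≡ σ x ⇒ σ (x ∧ y)
      σ-σ⊙ : ∀ x y → σ (σ x ⊙ σ y) ≡ σ x ⊙ σ y
      σ-σ⇒ : ∀ x y → σ (σ x ⇒ σ y) ≡ σ x ⇒ σ y
      σ-⊙ : ∀ x y → σ (x ⊙ y) ≡ σ x ⊙ σ y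

  -- Filters of a subalgebra S (given as a subset of the carrier closed
  -- under the operations; its order/operations are those of A).
  record IsFilterIn (S : Pred Carrier a) (F : Pred Carrier a) : Set a where
    field
      inside : F ⊆ S
      nonempty : ∃ λ x → F x
      ⊙-closed : ∀ x y → F x → F y → F (x ⊙ y)
      up-closed : ∀ x y → S y → F x → x ≤ y → F y

  Whole : Pred Carrier a
  Whole _ = Level.Lift a ⊤

  IsFilter : Pred Carrier a → Set a
  IsFilter = IsFilterIn Whole

  IsSimpleIn : Pred Carrier a → Set (lsuc a)
  IsSimpleIn S =
    Σ (Pred Carrier a) λ F → Σ (Pred Carrier a) λ G →
      IsFilterIn S F × IsFilterIn S G × ¬ (F ≐ G) ×
      (∀ H → IsFilterIn S H → (H ≐ F) ⊎ (H ≐ G))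

  IsProper : Pred Carrier a → Set a
  IsProper F = ∃ λ x → ¬ F x

  IsMaximalFilter : Pred Carrier a → Set (lsuc a)
  IsMaximalFilter F =
    IsFilter F × IsProper F ×
    (∀ G → IsFilter G → IsProper G → F ⊆ G → G ⊆ F)

  module _ (σ : Carrier → Carrier) where
    Image : Pred Carrier a
    Image x = ∃ λ y → σ y ≡ x

    Ker : Pred Carrier a
    Ker x = σ x ≡ 𝟙

    IsSimpleState : Set (lsuc a)
    IsSimpleState = IsSimpleIn Image

-- A subset S of a BL-algebra containing 𝟘 and 𝟙 and closed under ⊙ is simple
-- exactly when 𝟘 ≠ 𝟙 and every x ≠ 𝟙 in S is nilpotent: the filters {𝟙}, S and
-- the filter generated by x are then the only candidates, and a filter containing
-- a nilpotent element contains 𝟘, hence everything. For S = σ(A) the same local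
-- finiteness is equivalent to maximality of Ker σ: if σ x ≠ 𝟙 then σ(x)ⁿ = 𝟘, so
-- xⁿ ⇒ 𝟘 lies in Ker σ and any filter containing Ker σ and x contains 𝟘;
-- conversely the preimage under σ of the filter generated by σ x contains Ker σ
-- and x, so by maximality it contains 𝟘.
module Submission where

open import Defs
open import Level using (Level; lift)
open import Axiom.ExcludedMiddle using (ExcludedMiddle)
open import Axiom.DoubleNegationElimination using (DoubleNegationElimination; em⇒dne)
open import Function.Bundles using (_⇔_; mk⇔)
open import Function.Base using (_∘_)
open import Data.Nat using (ℕ; zero; suc; _+_)
open import Data.Product using (∃; _×_; _,_; proj₁; proj₂)
open import Data.Sum using (_⊎_; inj₁; inj₂)
open import Data.Empty using (⊥-elim)
open import Relation.Nullary using (¬_; yes; no)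
open import Relation.Unary using (Pred; _⊆_; _≐_)
open import Relation.Unary.Properties using (≐-sym; ≐-trans)
open import Relation.Binary.PropositionalEquality
open ≡-Reasoning

two-of-three : ∀ {b ℓ} {X : Set b} {F G P Q R : Pred X ℓ} →
  (P ≐ F) ⊎ (P ≐ G) → (Q ≐ F) ⊎ (Q ≐ G) → (R ≐ F) ⊎ (R ≐ G) →
  (P ≐ Q) ⊎ (P ≐ R) ⊎ (Q ≐ R)
two-of-three (inj₁ p) (inj₁ q) _        = inj₁ (≐-trans p (≐-sym q))
two-of-three (inj₂ p) (inj₂ q) _        = inj₁ (≐-trans p (≐-sym q))
two-of-three (inj₁ p) (inj₂ q) (inj₁ r) = inj₂ (inj₁ (≐-trans p (≐-sym r)))
two-of-three (inj₂ p) (inj₁ q) (inj₂ r) = inj₂ (inj₁ (≐-trans p (≐-sym r)))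
two-of-three (inj₁ p) (inj₂ q) (inj₂ r) = inj₂ (inj₂ (≐-trans q (≐-sym r)))
two-of-three (inj₂ p) (inj₁ q) (inj₁ r) = inj₂ (inj₂ (≐-trans q (≐-sym r)))

module _ {a : Level} (A : BLAlgebra a) where
  open BLAlgebra A

  ∧-idem : ∀ x → x ∧ x ≡ x
  ∧-idem x = trans (cong (x ∧_) (sym (∨-absorbs-∧ x x))) (∧-absorbs-∨ x (x ∧ x))

  ≤-refl : ∀ x → x ≤ x
  ≤-refl = ∧-idem

  ≤-trans : ∀ {x y z} → x ≤ y → y ≤ z → x ≤ z
  ≤-trans {x} {y} {z} x≤y y≤z = begin
    x ∧ z        ≡⟨ cong (_∧ z) (sym x≤y) ⟩
    (x ∧ y) ∧ z  ≡⟨ ∧-assoc x y z ⟩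
    x ∧ (y ∧ z)  ≡⟨ cong (x ∧_) y≤z ⟩
    x ∧ y        ≡⟨ x≤y ⟩
    x            ∎

  x≤𝟙 : ∀ x → x ≤ 𝟙
  x≤𝟙 x = trans (∧-comm x 𝟙) (𝟙-greatest x)

  𝟘≤x : ∀ x → 𝟘 ≤ x
  𝟘≤x x = trans (cong (𝟘 ∧_) (sym (𝟘-least x))) (∧-absorbs-∨ 𝟘 x)

  𝟙≤x⇒x≡𝟙 : ∀ {x} → 𝟙 ≤ x → x ≡ 𝟙
  𝟙≤x⇒x≡𝟙 {x} 𝟙≤x = trans (sym (𝟙-greatest x)) 𝟙≤x

  x≤𝟘⇒x≡𝟘 : ∀ {x} → x ≤ 𝟘 → x ≡ 𝟘
  x≤𝟘⇒x≡𝟘 {x} x≤𝟘 = trans (sym x≤𝟘) (trans (∧-comm x 𝟘) (𝟘≤x x))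

  𝟘≡𝟙⇒x≡𝟙 : 𝟘 ≡ 𝟙 → ∀ x → x ≡ 𝟙
  𝟘≡𝟙⇒x≡𝟙 𝟘≡𝟙 x = begin
    x      ≡⟨ sym (𝟙-greatest x) ⟩
    𝟙 ∧ x  ≡⟨ cong (_∧ x) (sym 𝟘≡𝟙) ⟩
    𝟘 ∧ x  ≡⟨ 𝟘≤x x ⟩
    𝟘      ≡⟨ 𝟘≡𝟙 ⟩
    𝟙      ∎

  ⊙-identityˡ : ∀ x → 𝟙 ⊙ x ≡ x
  ⊙-identityˡ x = trans (⊙-comm 𝟙 x) (⊙-identityʳ x)

  x⇒x≡𝟙 : ∀ x → x ⇒ x ≡ 𝟙
  x⇒x≡𝟙 x = 𝟙≤x⇒x≡𝟙 (residuation₂ x x 𝟙 (subst (_≤ x) (sym (⊙-identityʳ x)) (≤-refl x)))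

  x⊙y≤x : ∀ x y → x ⊙ y ≤ x
  x⊙y≤x x y = residuation₁ x x y (subst (y ≤_) (sym (x⇒x≡𝟙 x)) (x≤𝟙 y))

  x⊙[x⇒𝟘]≡𝟘 : ∀ x → x ⊙ (x ⇒ 𝟘) ≡ 𝟘
  x⊙[x⇒𝟘]≡𝟘 x = trans (sym (divisibility x 𝟘)) (trans (∧-comm x 𝟘) (𝟘≤x x))

  -- Divisibility writes x ≤ y as x = y ⊙ (y ⇒ x), exhibiting x ⊙ z as a lower bound of y ⊙ z.
  ⊙-monoˡ-≤ : ∀ {x y} z → x ≤ y → x ⊙ z ≤ y ⊙ z
  ⊙-monoˡ-≤ {x} {y} z x≤y = subst (_≤ y ⊙ z) (sym x⊙z≡y⊙z⊙[y⇒x]) (x⊙y≤x (y ⊙ z) (y ⇒ x))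
    where
    x⊙z≡y⊙z⊙[y⇒x] : x ⊙ z ≡ (y ⊙ z) ⊙ (y ⇒ x)
    x⊙z≡y⊙z⊙[y⇒x] = begin
      x ⊙ z              ≡⟨ cong (_⊙ z) (sym (trans (∧-comm y x) x≤y)) ⟩
      (y ∧ x) ⊙ z        ≡⟨ cong (_⊙ z) (divisibility y x) ⟩
      (y ⊙ (y ⇒ x)) ⊙ z  ≡⟨ ⊙-assoc y (y ⇒ x) z ⟩
      y ⊙ ((y ⇒ x) ⊙ z)  ≡⟨ cong (y ⊙_) (⊙-comm (y ⇒ x) z) ⟩
      y ⊙ (z ⊙ (y ⇒ x))  ≡⟨ sym (⊙-assoc y z (y ⇒ x)) ⟩
      (y ⊙ z) ⊙ (y ⇒ x)  ∎

  ⊙-mono-≤ : ∀ {x y u v} → x ≤ y → u ≤ v → x ⊙ u ≤ y ⊙ v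
  ⊙-mono-≤ {x} {y} {u} {v} x≤y u≤v = ≤-trans (⊙-monoˡ-≤ u x≤y)
    (subst₂ _≤_ (⊙-comm u y) (⊙-comm v y) (⊙-monoˡ-≤ y u≤v))

  infixr 8 _^_
  _^_ : Carrier → ℕ → Carrier
  x ^ zero  = 𝟙
  x ^ suc n = x ⊙ x ^ n

  ^-distribˡ-+-⊙ : ∀ x m n → x ^ (m + n) ≡ x ^ m ⊙ x ^ n
  ^-distribˡ-+-⊙ x zero    n = sym (⊙-identityˡ (x ^ n))
  ^-distribˡ-+-⊙ x (suc m) n =
    trans (cong (x ⊙_) (^-distribˡ-+-⊙ x m n)) (sym (⊙-assoc x (x ^ m) (x ^ n)))

  IsNilpotent : Carrier → Set a
  IsNilpotent x = ∃ λ n → x ^ n ≡ 𝟘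

  -- Nontriviality is part of the definition, since a simple algebra has 𝟘 ≠ 𝟙.
  IsLocallyFiniteIn : Pred Carrier a → Set a
  IsLocallyFiniteIn S = ¬ 𝟘 ≡ 𝟙 × (∀ {x} → S x → ¬ x ≡ 𝟙 → IsNilpotent x)

  ｛𝟙｝ : Pred Carrier a
  ｛𝟙｝ x = x ≡ 𝟙

  module _ {S F : Pred Carrier a} (F-filter : IsFilterIn A S F) where
    open IsFilterIn F-filter

    𝟙∈filter : S 𝟙 → F 𝟙
    𝟙∈filter S-𝟙 = up-closed (proj₁ nonempty) 𝟙 S-𝟙 (proj₂ nonempty) (x≤𝟙 _)

    ^∈filter : S 𝟙 → ∀ {x} → F x → ∀ n → F (x ^ n)
    ^∈filter S-𝟙 x∈F zero    = 𝟙∈filter S-𝟙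
    ^∈filter S-𝟙 x∈F (suc n) = ⊙-closed _ _ x∈F (^∈filter S-𝟙 x∈F n)

    𝟘∈filter⇒S⊆filter : F 𝟘 → S ⊆ F
    𝟘∈filter⇒S⊆filter 𝟘∈F {y} y∈S = up-closed 𝟘 y y∈S 𝟘∈F (𝟘≤x y)

  module Simplicity (S : Pred Carrier a) (S-𝟘 : S 𝟘) (S-𝟙 : S 𝟙)
                    (S-⊙ : ∀ {x y} → S x → S y → S (x ⊙ y)) where

    ｛𝟙｝-filter : IsFilterIn A S ｛𝟙｝
    ｛𝟙｝-filter = record
      { inside    = λ x≡𝟙 → subst S (sym x≡𝟙) S-𝟙
      ; nonempty  = 𝟙 , refl
      ; ⊙-closed  = λ _ _ x≡𝟙 y≡𝟙 → trans (cong₂ _⊙_ x≡𝟙 y≡𝟙) (⊙-identityʳ 𝟙)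
      ; up-closed = λ _ y _ x≡𝟙 x≤y → 𝟙≤x⇒x≡𝟙 (subst (_≤ y) x≡𝟙 x≤y)
      }

    whole-filter : IsFilterIn A S S
    whole-filter = record
      { inside    = λ x∈S → x∈S
      ; nonempty  = 𝟙 , S-𝟙
      ; ⊙-closed  = λ _ _ → S-⊙
      ; up-closed = λ _ _ y∈S _ _ → y∈S
      }

    ⟨_⟩ : Carrier → Pred Carrier a
    ⟨ b ⟩ y = S y × ∃ λ n → b ^ n ≤ y

    ⟨⟩-filter : ∀ {b} → IsFilterIn A S ⟨ b ⟩
    ⟨⟩-filter {b} = record
      { inside    = proj₁
      ; nonempty  = 𝟙 , S-𝟙 , 0 , ≤-refl 𝟙
      ; ⊙-closed  = λ { x y (x∈S , m , bᵐ≤x) (y∈S , n , bⁿ≤y) →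
          S-⊙ x∈S y∈S , m + n ,
          subst (_≤ x ⊙ y) (sym (^-distribˡ-+-⊙ b m n)) (⊙-mono-≤ bᵐ≤x bⁿ≤y) }
      ; up-closed = λ { x y y∈S (_ , n , bⁿ≤x) x≤y → y∈S , n , ≤-trans bⁿ≤x x≤y }
      }

    b∈⟨b⟩ : ∀ {b} → S b → ⟨ b ⟩ b
    b∈⟨b⟩ {b} b∈S = b∈S , 1 , subst (_≤ b) (sym (⊙-identityʳ b)) (≤-refl b)

    𝟘∈⟨b⟩⇒nilpotent : ∀ {b} → ⟨ b ⟩ 𝟘 → IsNilpotent b
    𝟘∈⟨b⟩⇒nilpotent (_ , n , bⁿ≤𝟘) = n , x≤𝟘⇒x≡𝟘 bⁿ≤𝟘

    trivial⇒filters-coincide : 𝟘 ≡ 𝟙 → ∀ {F G} →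
      IsFilterIn A S F → IsFilterIn A S G → F ≐ G
    trivial⇒filters-coincide 𝟘≡𝟙 F-filter G-filter =
        (λ {x} _ → subst _ (sym (𝟘≡𝟙⇒x≡𝟙 𝟘≡𝟙 x)) (𝟙∈filter G-filter S-𝟙))
      , (λ {x} _ → subst _ (sym (𝟘≡𝟙⇒x≡𝟙 𝟘≡𝟙 x)) (𝟙∈filter F-filter S-𝟙))

    simple⇒locallyFinite : IsSimpleIn A S → IsLocallyFiniteIn S
    simple⇒locallyFinite (F , G , F-filter , G-filter , F≉G , only-F-G) = 𝟘≢𝟙 , nilpotent
      where
      𝟘≢𝟙 : ¬ 𝟘 ≡ 𝟙
      𝟘≢𝟙 𝟘≡𝟙 = F≉G (trivial⇒filters-coincide 𝟘≡𝟙 F-filter G-filter)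

      nilpotent : ∀ {b} → S b → ¬ b ≡ 𝟙 → IsNilpotent b
      nilpotent {b} b∈S b≢𝟙
        with two-of-three (only-F-G ｛𝟙｝ ｛𝟙｝-filter) (only-F-G S whole-filter)
                          (only-F-G ⟨ b ⟩ ⟨⟩-filter)
      ... | inj₁ ｛𝟙｝≐S          = ⊥-elim (𝟘≢𝟙 (proj₂ ｛𝟙｝≐S S-𝟘))
      ... | inj₂ (inj₁ ｛𝟙｝≐⟨b⟩) = ⊥-elim (b≢𝟙 (proj₂ ｛𝟙｝≐⟨b⟩ (b∈⟨b⟩ b∈S)))
      ... | inj₂ (inj₂ S≐⟨b⟩)    = 𝟘∈⟨b⟩⇒nilpotent (proj₁ S≐⟨b⟩ S-𝟘)

    locallyFinite⇒simple : ExcludedMiddle a → IsLocallyFiniteIn S → IsSimpleIn A S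
    locallyFinite⇒simple em (𝟘≢𝟙 , nilpotent) =
      ｛𝟙｝ , S , ｛𝟙｝-filter , whole-filter , (λ ｛𝟙｝≐S → 𝟘≢𝟙 (proj₂ ｛𝟙｝≐S S-𝟘)) , classify
      where
      classify : ∀ H → IsFilterIn A S H → (H ≐ ｛𝟙｝) ⊎ (H ≐ S)
      classify H H-filter with em {∃ λ b → H b × ¬ b ≡ 𝟙}
      ... | no ∄b = inj₁
        ( (λ {x} x∈H → em⇒dne em (λ x≢𝟙 → ∄b (x , x∈H , x≢𝟙)))
        , (λ {x} x≡𝟙 → subst H (sym x≡𝟙) (𝟙∈filter H-filter S-𝟙)) )
      ... | yes (b , b∈H , b≢𝟙) = inj₂ (inside , 𝟘∈filter⇒S⊆filter H-filter 𝟘∈H)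
        where
        open IsFilterIn H-filter
        𝟘∈H : H 𝟘
        𝟘∈H with nilpotent (inside b∈H) b≢𝟙
        ... | n , bⁿ≡𝟘 = subst H bⁿ≡𝟘 (^∈filter H-filter S-𝟙 b∈H n)

  module _ (σ : Carrier → Carrier) (σ-state : IsStateMorphism A σ) where
    open IsStateMorphism σ-state

    σ-mono : ∀ {x y} → x ≤ y → σ x ≤ σ y
    σ-mono {x} {y} x≤y = subst (_≤ σ y) (sym σx≡σy⊙σ[y⇒x]) (x⊙y≤x (σ y) (σ (y ⇒ x)))
      where
      σx≡σy⊙σ[y⇒x] : σ x ≡ σ y ⊙ σ (y ⇒ x)
      σx≡σy⊙σ[y⇒x] = begin
        σ x              ≡⟨ cong σ (trans (sym x≤y) (∧-comm x y)) ⟩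
        σ (y ∧ x)        ≡⟨ cong σ (divisibility y x) ⟩
        σ (y ⊙ (y ⇒ x))  ≡⟨ σ-⊙ y (y ⇒ x) ⟩
        σ y ⊙ σ (y ⇒ x)  ∎

    σ-𝟙 : σ 𝟙 ≡ 𝟙
    σ-𝟙 = begin
      σ 𝟙                ≡⟨ cong σ (sym (x⇒x≡𝟙 𝟙)) ⟩
      σ (𝟙 ⇒ 𝟙)          ≡⟨ σ-⇒ 𝟙 𝟙 ⟩
      σ 𝟙 ⇒ σ (𝟙 ∧ 𝟙)    ≡⟨ cong (λ t → σ 𝟙 ⇒ σ t) (∧-idem 𝟙) ⟩
      σ 𝟙 ⇒ σ 𝟙          ≡⟨ x⇒x≡𝟙 (σ 𝟙) ⟩
      𝟙                  ∎

    σ-idem : ∀ x → σ (σ x) ≡ σ x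
    σ-idem x = begin
      σ (σ x)          ≡⟨ cong σ (sym σx⊙σ𝟙≡σx) ⟩
      σ (σ x ⊙ σ 𝟙)    ≡⟨ σ-σ⊙ x 𝟙 ⟩
      σ x ⊙ σ 𝟙        ≡⟨ σx⊙σ𝟙≡σx ⟩
      σ x              ∎
      where
      σx⊙σ𝟙≡σx : σ x ⊙ σ 𝟙 ≡ σ x
      σx⊙σ𝟙≡σx = trans (cong (σ x ⊙_) σ-𝟙) (⊙-identityʳ (σ x))

    σ-^ : ∀ x n → σ (x ^ n) ≡ σ x ^ n
    σ-^ x zero    = σ-𝟙
    σ-^ x (suc n) = trans (σ-⊙ x (x ^ n)) (cong (σ x ⊙_) (σ-^ x n))

    σx≡𝟘⇒σ[x⇒𝟘]≡𝟙 : ∀ {x} → σ x ≡ 𝟘 → σ (x ⇒ 𝟘) ≡ 𝟙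
    σx≡𝟘⇒σ[x⇒𝟘]≡𝟙 {x} σx≡𝟘 = begin
      σ (x ⇒ 𝟘)          ≡⟨ σ-⇒ x 𝟘 ⟩
      σ x ⇒ σ (x ∧ 𝟘)    ≡⟨ cong₂ _⇒_ σx≡𝟘 (cong σ (trans (∧-comm x 𝟘) (𝟘≤x x))) ⟩
      𝟘 ⇒ σ 𝟘            ≡⟨ cong (𝟘 ⇒_) σ-𝟘 ⟩
      𝟘 ⇒ 𝟘              ≡⟨ x⇒x≡𝟙 𝟘 ⟩
      𝟙                  ∎

    σ-fixes-image : ∀ {x} → Image A σ x → σ x ≡ x
    σ-fixes-image (y , σy≡x) = trans (cong σ (sym σy≡x)) (trans (σ-idem y) σy≡x)

    Image-𝟘 : Image A σ 𝟘
    Image-𝟘 = 𝟘 , σ-𝟘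

    Image-𝟙 : Image A σ 𝟙
    Image-𝟙 = 𝟙 , σ-𝟙

    Image-⊙ : ∀ {x y} → Image A σ x → Image A σ y → Image A σ (x ⊙ y)
    Image-⊙ (x′ , σx′≡x) (y′ , σy′≡y) = x′ ⊙ y′ , trans (σ-⊙ x′ y′) (cong₂ _⊙_ σx′≡x σy′≡y)

    preimage-filter : ∀ {F} → IsFilterIn A (Image A σ) F → IsFilter A (F ∘ σ)
    preimage-filter {F} F-filter = record
      { inside    = λ _ → lift _
      ; nonempty  = 𝟙 , subst F (sym σ-𝟙) (𝟙∈filter F-filter (𝟙 , σ-𝟙))
      ; ⊙-closed  = λ x y σx∈F σy∈F → subst F (sym (σ-⊙ x y)) (⊙-closed _ _ σx∈F σy∈F)
      ; up-closed = λ x y _ σx∈F x≤y → up-closed _ _ (y , refl) σx∈F (σ-mono x≤y)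
      }
      where open IsFilterIn F-filter

    open Simplicity (Image A σ) Image-𝟘 Image-𝟙 Image-⊙
      using (｛𝟙｝-filter; ⟨_⟩; ⟨⟩-filter; b∈⟨b⟩; 𝟘∈⟨b⟩⇒nilpotent)

    ker-filter : IsFilter A (Ker A σ)
    ker-filter = preimage-filter ｛𝟙｝-filter

    locallyFinite⇒ker-maximal : DoubleNegationElimination a →
      IsLocallyFiniteIn (Image A σ) → IsMaximalFilter A (Ker A σ)
    locallyFinite⇒ker-maximal dne (𝟘≢𝟙 , nilpotent) =
      ker-filter , (𝟘 , λ σ𝟘≡𝟙 → 𝟘≢𝟙 (trans (sym σ-𝟘) σ𝟘≡𝟙)) , maximal
      where
      maximal : ∀ G → IsFilter A G → IsProper A G → Ker A σ ⊆ G → G ⊆ Ker A σ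
      maximal G G-filter (y , y∉G) ker⊆G {x} x∈G = dne λ σx≢𝟙 →
        let (n , σxⁿ≡𝟘) = nilpotent (x , refl) σx≢𝟙
            σ[xⁿ]≡𝟘 = trans (σ-^ x n) σxⁿ≡𝟘
            xⁿ⊙¬xⁿ∈G = ⊙-closed _ _ (^∈filter G-filter (lift _) x∈G n)
                                    (ker⊆G (σx≡𝟘⇒σ[x⇒𝟘]≡𝟙 σ[xⁿ]≡𝟘))
        in  y∉G (𝟘∈filter⇒S⊆filter G-filter (subst G (x⊙[x⇒𝟘]≡𝟘 (x ^ n)) xⁿ⊙¬xⁿ∈G) (lift _))
        where open IsFilterIn G-filter

    ker-maximal⇒locallyFinite : DoubleNegationElimination a →
      IsMaximalFilter A (Ker A σ) → IsLocallyFiniteIn (Image A σ)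
    ker-maximal⇒locallyFinite dne (_ , (z , z∉ker) , maximal) = 𝟘≢𝟙 , nilpotent
      where
      𝟘≢𝟙 : ¬ 𝟘 ≡ 𝟙
      𝟘≢𝟙 𝟘≡𝟙 = z∉ker (𝟘≡𝟙⇒x≡𝟙 𝟘≡𝟙 (σ z))

      nilpotent : ∀ {b} → Image A σ b → ¬ b ≡ 𝟙 → IsNilpotent b
      nilpotent {b} b∈σA b≢𝟙 = 𝟘∈⟨b⟩⇒nilpotent (subst ⟨ b ⟩ σ-𝟘 σ𝟘∈⟨b⟩)
        where
        ⟨b⟩-filter : IsFilterIn A (Image A σ) ⟨ b ⟩
        ⟨b⟩-filter = ⟨⟩-filter

        ker⊆σ⁻¹⟨b⟩ : Ker A σ ⊆ ⟨ b ⟩ ∘ σ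
        ker⊆σ⁻¹⟨b⟩ σy≡𝟙 = subst ⟨ b ⟩ (sym σy≡𝟙) (𝟙∈filter ⟨b⟩-filter Image-𝟙)

        b∈σ⁻¹⟨b⟩ : ⟨ b ⟩ (σ b)
        b∈σ⁻¹⟨b⟩ = subst ⟨ b ⟩ (sym (σ-fixes-image b∈σA)) (b∈⟨b⟩ b∈σA)

        σ𝟘∈⟨b⟩ : ⟨ b ⟩ (σ 𝟘)
        σ𝟘∈⟨b⟩ = dne λ σ𝟘∉⟨b⟩ → b≢𝟙 (trans (sym (σ-fixes-image b∈σA))
          (maximal (⟨ b ⟩ ∘ σ) (preimage-filter ⟨b⟩-filter) (𝟘 , σ𝟘∉⟨b⟩) ker⊆σ⁻¹⟨b⟩ b∈σ⁻¹⟨b⟩))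

theorem7p3 : {a : Level} → ExcludedMiddle a →
    (A : BLAlgebra a) → (σ : BLAlgebra.Carrier A → BLAlgebra.Carrier A) →
    IsStateMorphism A σ →
    IsSimpleState A σ ⇔ IsMaximalFilter A (Ker A σ)
theorem7p3 em A σ σ-state = mk⇔
  (locallyFinite⇒ker-maximal A σ σ-state (em⇒dne em) ∘ simple⇒locallyFinite)
  (locallyFinite⇒simple em ∘ ker-maximal⇒locallyFinite A σ σ-state (em⇒dne em))
  where
  open Simplicity A (Image A σ) (Image-𝟘 A σ σ-state) (Image-𝟙 A σ σ-state) (Image-⊙ A σ σ-state)
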